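{- Let $S$ be a set of service centers, $D$ a set of demand units, $\mathcal{CM}:D\times S\to\mathbb{Z}_{>0}$ a cost matrix, and let $\mathcal{A}3$ be an allotment such that $\Gamma(\mathcal{A}3)$ has no directed cycle of negative total cost. Let $s^*\in S$ and, for each $u\in S\setminus\{s^*\}$, let $w_u$ be a given real number (the penalty at $u$ minus the penalty at $s^*$). Among all pairs $(s_l,P)$ with $s_l\in S\setminus\{s^*\}$ and $P$ a directed path in $\Gamma(\mathcal{A}3)$ from $s^*$ to $s_l$ with pairwise distinct vertices, choose one minimizing $\mathrm{cost}(P)+w_{s_l}$. If this minimum value is negative, let $\mathcal{A}4$ be obtained from $\mathcal{A}3$ by performing the transfers of all edges of $P$; otherwise let $\mathcal{A}4=\mathcal{A}3$. Then $\Gamma(\mathcal{A}4)$ has no directed cycle of negative total cost.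
   Context: An allotment is a set of pairs $\langle d,s\rangle$ with $d\in D$, $s\in S$, each demand unit appearing in at most one pair. For an allotment $\mathcal{A}$, the allotment subspace multigraph $\Gamma(\mathcal{A})$ has vertex set $S$ and, for every $\langle d,s_p\rangle\in\mathcal{A}$ and every $s_q\neq s_p$, a directed edge $(s_p,s_q,d)$ of cost $\mathcal{CM}(d,s_q)-\mathcal{CM}(d,s_p)$, representing the transfer of $d$ from $s_p$ to $s_q$. Costs of paths and cycles are sums of edge costs. Performing the transfer of edge $(s_p,s_q,d)$ replaces $\langle d,s_p\rangle$ by $\langle d,s_q\rangle$; along a path with distinct vertices the edges have distinct tails and thus move distinct demand units. In the algorithm where this is used, $w_u$ is the penalty incurred by allotting one more demand unit to $u$ minus the penalty saved at the overloaded center $s^*$ by removing one unit from it.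
   Formalization: The penalty differences $w_u$ are rational rather than real. -}

module Defs where

open import Data.Nat as ℕ using (ℕ)
open import Data.Integer as ℤ using (ℤ; +_)
open import Data.Rational as ℚ using (ℚ; 0ℚ)
open import Data.Rational.Properties as ℚP using ()
open import Data.Fin using (Fin; _≟_)
open import Data.Maybe using (Maybe; just)
open import Data.List using (List; []; _∷_; map; foldl)
open import Data.List.Relation.Unary.Unique.Propositional using (Unique)
open import Data.Empty using (⊥)
open import Data.Product using (Σ; _×_)
open import Relation.Binary.PropositionalEquality using (_≡_; _≢_)
open import Relation.Nullary using (¬_; yes; no)

-- Service centres S = Fin m, demand units D = Fin n.
-- An allotment assigns each demand unit to at most one centre.
Allotment : ℕ → ℕ → Set
Allotment n m = Fin n → Maybe (Fin m)

-- Cost matrix CM : D × S → ℤ_{>0}  (natural numbers, positivity is a hypothesis)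
CostMatrix : ℕ → ℕ → Set
CostMatrix n m = Fin n → Fin m → ℕ

record Edge (n m : ℕ) : Set where
  constructor edge
  field
    tail : Fin m
    head : Fin m
    dem  : Fin n
open Edge public

InΓ : ∀ {n m} → Allotment n m → Edge n m → Set
InΓ A e = (A (dem e) ≡ just (tail e)) × (head e ≢ tail e)

edgeCost : ∀ {n m} → CostMatrix n m → Edge n m → ℤ
edgeCost CM e = (+ CM (dem e) (head e)) ℤ.- (+ CM (dem e) (tail e))

cost : ∀ {n m} → CostMatrix n m → List (Edge n m) → ℤ
cost CM []       = + 0
cost CM (e ∷ es) = edgeCost CM e ℤ.+ cost CM es

data Walk {n m : ℕ} (A : Allotment n m) : Fin m → Fin m → List (Edge n m) → Set where
  nil  : ∀ {s} → Walk A s s []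
  cons : ∀ {t es} (e : Edge n m) → InΓ A e → Walk A (head e) t es → Walk A (tail e) t (e ∷ es)

vertices : ∀ {n m} → Fin m → List (Edge n m) → List (Fin m)
vertices s []       = s ∷ []
vertices s (e ∷ es) = s ∷ vertices (head e) es

IsPath : ∀ {n m} → Allotment n m → Fin m → Fin m → List (Edge n m) → Set
IsPath A s t es = Walk A s t es × Unique (vertices s es)

IsCycle : ∀ {n m} → Allotment n m → List (Edge n m) → Set
IsCycle A []       = ⊥
IsCycle A (e ∷ es) = Walk A (tail e) (tail e) (e ∷ es) × Unique (map tail (e ∷ es))

NoNegativeCycle : ∀ {n m} → CostMatrix n m → Allotment n m → Set
NoNegativeCycle {n} {m} CM A = ∀ (es : List (Edge n m)) → IsCycle A es → ¬ (cost CM es ℤ.< + 0)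

transfer : ∀ {n m} → Allotment n m → Edge n m → Allotment n m
transfer A e d with d ≟ dem e
... | yes _ = just (head e)
... | no  _ = A d

transferAll : ∀ {n m} → Allotment n m → List (Edge n m) → Allotment n m
transferAll = foldl transfer

toℚ : ℤ → ℚ
toℚ z = z ℚ./ 1

value : ∀ {n m} → CostMatrix n m → (Fin m → ℚ) → Fin m → List (Edge n m) → ℚ
value CM w sl P = toℚ (cost CM P) ℚ.+ w sl

nextAllotment : ∀ {n m} → CostMatrix n m → (Fin m → ℚ) → Allotment n m → Fin m → List (Edge n m) → Allotment n m
nextAllotment CM w A3 sl P with value CM w sl P ℚP.<? 0ℚ
... | yes _ = transferAll A3 P
... | no  _ = A3

-- Let π(v) be the cost of a cheapest simple path from s* to v in Γ(A3); every v has such a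
-- path, since the first edge of P shows that s* holds a demand unit.  As Γ(A3) has no
-- negative cycle, π is a feasible potential: π(q) ≤ π(p) + c(e) for every edge e : p → q
-- (a cheapest path to p that already visits q would close a cycle with e).  Taking u = s_l
-- in the minimality hypothesis shows that P is a cheapest path to s_l, so every edge of P
-- is tight.  A unit moved along a tight edge p → q gives rise to edges q → r of cost
-- c(p → r) − c(p → q) ≥ π(r) − π(q), so π stays feasible for Γ(A4), and a feasible
-- potential excludes negative cycles by telescoping.
module Submission where

open import Defs
open import Data.Nat using (ℕ; _<_)
open import Data.Fin using (Fin)
open import Data.List using (List)
open import Data.Rational using (ℚ; _≤_)
open import Relation.Binary.PropositionalEquality using (_≢_)

import Algebra.Properties.Group as GroupProperties
open import Algebra.Bundles using (AbelianGroup)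
import Data.Nat as ℕ
import Data.Nat.Properties as ℕP
open import Data.Integer as ℤ using (ℤ; +_)
import Data.Integer.Properties as ℤP
import Data.Integer.GCD as ℤGCD
open import Data.Integer.Tactic.RingSolver using (solve-∀)
import Data.Rational as ℚ
open import Data.Rational using (↥_; ↧_; *≤*; 0ℚ)
import Data.Rational.Properties as ℚP
open import Data.Empty using (⊥-elim)
open import Data.Fin using (zero; suc; _≟_)
open import Data.Fin.Properties using (injective⇒≤)
open import Data.List as L
  using ([]; _∷_; [_]; _++_; _∷ʳ_; map; length; filter; allFin; cartesianProductWith)
import Data.List.Properties as LP
open import Data.List.Extrema ℤP.≤-totalOrder using (argmin; argmin-all; f[argmin]≤f[xs])
open import Data.List.Relation.Unary.Any using (here; there)
open import Data.List.Relation.Unary.All as All using (All; []; _∷_)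
open import Data.List.Relation.Unary.All.Properties using (all-filter)
open import Data.List.Relation.Unary.AllPairs using ([]; _∷_)
open import Data.List.Membership.Propositional using (_∈_; _∉_)
open import Data.List.Membership.Propositional.Properties
  using (∈-lookup; ∈-allFin; ∈-filter⁺; ∈-cartesianProductWith⁺)
import Data.List.Membership.DecPropositional as DecMembership
open import Data.List.Relation.Unary.Unique.Propositional using (Unique)
import Data.List.Relation.Unary.Unique.Propositional.Properties as Unique
import Data.List.Relation.Unary.Unique.DecPropositional as DecUnique
open import Data.Maybe using (just)
import Data.Maybe.Properties as MaybeP
open import Data.Product using (_×_; _,_; proj₁; proj₂; ∃)
open import Data.Sum using (_⊎_; inj₁; inj₂)
open import Function using (_$_; _∘_)
open import Function.Definitions using (Injective)
open import Relation.Nullary using (yes; no)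
open import Relation.Nullary.Decidable using (_×-dec_; ¬?)
open import Relation.Unary using (Decidable)
open import Relation.Binary.PropositionalEquality
  using (_≡_; refl; sym; trans; cong; cong₂; subst; subst₂)

ℤ-+-cancelʳ-≤ : ∀ k {i j} → i ℤ.+ k ℤ.≤ j ℤ.+ k → i ℤ.≤ j
ℤ-+-cancelʳ-≤ k {i} {j} =
  subst₂ ℤ._≤_ (//-rightDividesʳ k i) (//-rightDividesʳ k j) ∘ ℤP.+-monoˡ-≤ (ℤ.- k)
  where open GroupProperties (AbelianGroup.group ℤP.+-0-abelianGroup)

ℤ-+-cancelˡ-≤ : ∀ k {i j} → k ℤ.+ i ℤ.≤ k ℤ.+ j → i ℤ.≤ j
ℤ-+-cancelˡ-≤ k {i} {j} = ℤ-+-cancelʳ-≤ k ∘ subst₂ ℤ._≤_ (ℤP.+-comm k i) (ℤP.+-comm k j)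

ℚ-+-cancelʳ-≤ : ∀ k {p q} → p ℚ.+ k ≤ q ℚ.+ k → p ≤ q
ℚ-+-cancelʳ-≤ k {p} {q} =
  subst₂ _≤_ (//-rightDividesʳ k p) (//-rightDividesʳ k q) ∘ ℚP.+-monoˡ-≤ (ℚ.- k)
  where open GroupProperties ℚP.+-0-group

-- toℚ z = z / 1 is already in normal form, as gcd z 1 = 1.
↥-toℚ : ∀ z → ↥ toℚ z ≡ z
↥-toℚ z = trans (sym (ℤP.*-identityʳ _))
                (trans (cong (↥ toℚ z ℤ.*_) (sym (ℤGCD.gcd-zeroʳ z))) (ℚP.↥-/ z 1))

↧-toℚ : ∀ z → ↧ toℚ z ≡ + 1
↧-toℚ z = trans (sym (ℤP.*-identityʳ _))
                (trans (cong (↧ toℚ z ℤ.*_) (sym (ℤGCD.gcd-zeroʳ z))) (ℚP.↧-/ z 1))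

toℚ-cancel-≤ : ∀ {i j} → toℚ i ≤ toℚ j → i ℤ.≤ j
toℚ-cancel-≤ {i} {j} (*≤* h) = subst₂ ℤ._≤_ (numerator i j) (numerator j i) h
  where
  numerator : ∀ x y → ↥ toℚ x ℤ.* ↧ toℚ y ≡ x
  numerator x y = trans (cong₂ ℤ._*_ (↥-toℚ x) (↧-toℚ y)) (ℤP.*-identityʳ x)

module _ {a} {A : Set a} where

  unique⇒lookup-injective : ∀ {xs : List A} → Unique xs → Injective _≡_ _≡_ (L.lookup xs)
  unique⇒lookup-injective {_ ∷ _} _        {zero}  {zero}  _  = refl
  unique⇒lookup-injective {_ ∷ _} (x∉ ∷ _) {zero}  {suc j} eq = ⊥-elim (All.lookup x∉ (∈-lookup j) eq)
  unique⇒lookup-injective {_ ∷ _} (x∉ ∷ _) {suc i} {zero}  eq =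
    ⊥-elim (All.lookup x∉ (∈-lookup i) (sym eq))
  unique⇒lookup-injective {_ ∷ _} (_ ∷ u)  {suc i} {suc j} eq = cong suc (unique⇒lookup-injective u eq)

  listsOfLength≤ : List A → ℕ → List (List A)
  listsOfLength≤ xs ℕ.zero    = [ [] ]
  listsOfLength≤ xs (ℕ.suc k) = [] ∷ cartesianProductWith _∷_ xs (listsOfLength≤ xs k)

  ∈-listsOfLength≤ : ∀ {xs ys : List A} k → All (_∈ xs) ys → length ys ℕ.≤ k →
                     ys ∈ listsOfLength≤ xs k
  ∈-listsOfLength≤ ℕ.zero    []         _           = here refl
  ∈-listsOfLength≤ (ℕ.suc k) []         _           = here refl
  ∈-listsOfLength≤ (ℕ.suc k) (y∈ ∷ ys∈) (ℕ.s≤s len) =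
    there (∈-cartesianProductWith⁺ _∷_ y∈ (∈-listsOfLength≤ k ys∈ len))

unique⇒length≤ : ∀ {m} {xs : List (Fin m)} → Unique xs → length xs ℕ.≤ m
unique⇒length≤ = injective⇒≤ ∘ unique⇒lookup-injective

module _ {n m : ℕ} where

  allEdges : List (Edge n m)
  allEdges = cartesianProductWith _$_ (cartesianProductWith edge (allFin m) (allFin m)) (allFin n)

  ∈-allEdges : ∀ e → e ∈ allEdges
  ∈-allEdges (edge t h d) =
    ∈-cartesianProductWith⁺ _$_ (∈-cartesianProductWith⁺ edge (∈-allFin t) (∈-allFin h)) (∈-allFin d)

  length-vertices : ∀ s (es : List (Edge n m)) → length (vertices s es) ≡ ℕ.suc (length es)
  length-vertices s []       = refl
  length-vertices s (e ∷ es) = cong ℕ.suc (length-vertices (head e) es)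

  vertices-++⁺ˡ : ∀ {s x} (es fs : List (Edge n m)) → x ∈ vertices s es → x ∈ vertices s (es ++ fs)
  vertices-++⁺ˡ []       []       x∈         = x∈
  vertices-++⁺ˡ []       (f ∷ fs) (here eq)  = here eq
  vertices-++⁺ˡ (e ∷ es) fs       (here eq)  = here eq
  vertices-++⁺ˡ (e ∷ es) fs       (there x∈) = there (vertices-++⁺ˡ es fs x∈)

  cost-++ : ∀ CM (es fs : List (Edge n m)) → cost CM (es ++ fs) ≡ cost CM es ℤ.+ cost CM fs
  cost-++ CM []       fs = sym (ℤP.+-identityˡ _)
  cost-++ CM (e ∷ es) fs = trans (cong (λ c → edgeCost CM e ℤ.+ c) (cost-++ CM es fs))
                                 (sym (ℤP.+-assoc (edgeCost CM e) (cost CM es) (cost CM fs)))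

  cost-∷ʳ : ∀ CM (es : List (Edge n m)) e → cost CM (es ∷ʳ e) ≡ cost CM es ℤ.+ edgeCost CM e
  cost-∷ʳ CM es e = trans (cost-++ CM es [ e ]) (cong (λ c → cost CM es ℤ.+ c) (ℤP.+-identityʳ _))

  module _ {A : Allotment n m} where

    walk-++ : ∀ {s u t} {es fs : List (Edge n m)} → Walk A s u es → Walk A u t fs → Walk A s t (es ++ fs)
    walk-++ nil          w′ = w′
    walk-++ (cons e p w) w′ = cons e p (walk-++ w w′)

    walk-edges : ∀ {s t} {es : List (Edge n m)} → Walk A s t es → All (InΓ A) es
    walk-edges nil          = []
    walk-edges (cons e p w) = p ∷ walk-edges w

    walk-vertices : ∀ {s t} {es : List (Edge n m)} → Walk A s t es → vertices s es ≡ map tail es ∷ʳ t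
    walk-vertices nil          = refl
    walk-vertices (cons e p w) = cong (tail e ∷_) (walk-vertices w)

    path-length≤ : ∀ {s t} {es : List (Edge n m)} → IsPath A s t es → length es ℕ.≤ m
    path-length≤ {s} {es = es} (_ , u) =
      ℕP.<⇒≤ (subst (ℕ._≤ m) (length-vertices s es) (unique⇒length≤ u))

    inΓ? : Decidable (InΓ A)
    inΓ? e = MaybeP.≡-dec _≟_ (A (dem e)) (just (tail e)) ×-dec ¬? (head e ≟ tail e)

    walk? : ∀ s t → Decidable (Walk A s t)
    walk? s t [] with s ≟ t
    ... | yes refl = yes nil
    ... | no s≢t   = no λ { nil → s≢t refl }
    walk? s t (e ∷ es) with s ≟ tail e
    ... | no s≢tail = no λ { (cons _ _ _) → s≢tail refl }
    ... | yes refl with inΓ? e | walk? (head e) t es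
    ...   | yes p  | yes w  = yes (cons e p w)
    ...   | no ¬p  | _      = no λ { (cons _ p _) → ¬p p }
    ...   | yes _  | no ¬w  = no λ { (cons _ _ w) → ¬w w }

    isPath? : ∀ s t → Decidable (IsPath A s t)
    isPath? s t es = walk? s t es ×-dec DecUnique.unique? _≟_ (vertices s es)

    split-path : ∀ {s t v} {es : List (Edge n m)} → IsPath A s t es → v ∈ vertices s es →
                 ∃ λ es₁ → ∃ λ es₂ → es ≡ es₁ ++ es₂ × IsPath A s v es₁ × IsPath A v t es₂
    split-path {es = []}    (nil , u)         (here refl) = [] , [] , refl , (nil , u) , (nil , u)
    split-path {es = e ∷ _} (cons e p w , u)  (here refl) = [] , _ , refl , (nil , [] ∷ []) , (cons e p w , u)
    split-path (cons e p w , tail∉ ∷ u) (there v∈) with split-path (w , u) v∈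
    ... | es₁ , es₂ , refl , (w₁ , u₁) , path₂ =
      e ∷ es₁ , es₂ , refl ,
      (cons e p w₁ , All.tabulate (All.lookup tail∉ ∘ vertices-++⁺ˡ es₁ es₂) ∷ u₁) , path₂

    path-∷ʳ : ∀ {s} {e : Edge n m} {es} → IsPath A s (tail e) es → InΓ A e → head e ∉ vertices s es →
              IsPath A s (head e) (es ∷ʳ e)
    path-∷ʳ {s} {e} {es} (w , u) p head∉ =
      walk-++ w (cons e p nil) ,
      subst Unique (sym (vertices-∷ʳ s es))
            (Unique.++⁺ u ([] ∷ []) λ { (x∈ , here refl) → head∉ x∈ })
      where
      vertices-∷ʳ : ∀ s es → vertices s (es ∷ʳ e) ≡ vertices s es ∷ʳ head e
      vertices-∷ʳ s []       = refl
      vertices-∷ʳ s (f ∷ es) = cong (s ∷_) (vertices-∷ʳ (head f) es)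

    path-∷ʳ-cycle : ∀ {e : Edge n m} {es} → IsPath A (head e) (tail e) es → InΓ A e → IsCycle A (es ∷ʳ e)
    path-∷ʳ-cycle {edge t h d} {[]}     (nil , _) (_ , h≢t) = ⊥-elim (h≢t refl)
    path-∷ʳ-cycle {edge t h d} {f ∷ es} (w@(cons _ _ _) , u) p =
      walk-++ w (cons _ p nil) ,
      subst Unique (trans (walk-vertices w) (sym (LP.map-++ tail (f ∷ es) _))) u

    occupied-source : ∀ {s t} {es : List (Edge n m)} → Walk A s t es → t ≢ s → ∃ λ d → A d ≡ just s
    occupied-source nil          t≢s = ⊥-elim (t≢s refl)
    occupied-source (cons e p _) _   = dem e , proj₁ p

    occupied⇒path : ∀ {s d} → A d ≡ just s → ∀ v → ∃ (IsPath A s v)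
    occupied⇒path {s} {d} occ v with v ≟ s
    ... | yes refl = [] , nil , [] ∷ []
    ... | no v≢s   = [ edge s v d ] , cons _ (occ , v≢s) nil , ((v≢s ∘ sym) ∷ []) ∷ [] ∷ []

record ShortestPath {n m} (CM : CostMatrix n m) (A : Allotment n m) (s t : Fin m) : Set where
  field
    path    : List (Edge n m)
    isPath  : IsPath A s t path
    minimal : ∀ {es} → IsPath A s t es → cost CM path ℤ.≤ cost CM es

-- Simple paths have fewer than m edges, so a cheapest one is found among finitely many lists.
shortestPath : ∀ {n m} {CM : CostMatrix n m} {A s t} → ∃ (IsPath A s t) → ShortestPath CM A s t
shortestPath {m = m} {CM} {A} {s} {t} (es₀ , path₀) = record
  { path    = argmin (cost CM) es₀ candidates
  ; isPath  = argmin-all (cost CM) path₀ (all-filter (isPath? s t) (listsOfLength≤ allEdges m))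
  ; minimal = λ path → All.lookup (f[argmin]≤f[xs] es₀ candidates) (∈-candidates path)
  }
  where
  candidates : List (List (Edge _ m))
  candidates = filter (isPath? s t) (listsOfLength≤ allEdges m)
  ∈-candidates : ∀ {es} → IsPath A s t es → es ∈ candidates
  ∈-candidates path = ∈-filter⁺ (isPath? s t)
    (∈-listsOfLength≤ m (All.tabulate (λ {e} _ → ∈-allEdges e)) (path-length≤ path)) path

transferAll-cases : ∀ {n m} (A : Allotment n m) es d →
  transferAll A es d ≡ A d ⊎ ∃ λ e → e ∈ es × dem e ≡ d × transferAll A es d ≡ just (head e)
transferAll-cases A []       d = inj₁ refl
transferAll-cases A (e ∷ es) d with transferAll-cases (transfer A e) es d
... | inj₂ (f , f∈es , dem≡ , moved) = inj₂ (f , there f∈es , dem≡ , moved)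
... | inj₁ unchanged with d ≟ dem e
...   | yes refl = inj₂ (e , here refl , refl , unchanged)
...   | no _     = inj₁ unchanged

module _ {n m : ℕ} (CM : CostMatrix n m) (π : Fin m → ℤ) where
  open ℤP.≤-Reasoning

  Feasible : Allotment n m → Set
  Feasible A = ∀ e → InΓ A e → π (head e) ℤ.≤ π (tail e) ℤ.+ edgeCost CM e

  Tight : Edge n m → Set
  Tight e = π (tail e) ℤ.+ edgeCost CM e ℤ.≤ π (head e)

  module _ {A : Allotment n m} (feasible : Feasible A) where

    feasible-walk : ∀ {s t es} → Walk A s t es → π t ℤ.≤ π s ℤ.+ cost CM es
    feasible-walk {s} nil = ℤP.≤-reflexive (sym (ℤP.+-identityʳ (π s)))
    feasible-walk {t = t} (cons {es = es} e p w) = begin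
      π t                                         ≤⟨ feasible-walk w ⟩
      π (head e) ℤ.+ cost CM es                   ≤⟨ ℤP.+-monoˡ-≤ (cost CM es) (feasible e p) ⟩
      π (tail e) ℤ.+ edgeCost CM e ℤ.+ cost CM es ≡⟨ ℤP.+-assoc (π (tail e)) (edgeCost CM e) (cost CM es) ⟩
      π (tail e) ℤ.+ cost CM (e ∷ es)             ∎

    feasible⇒noNegativeCycle : NoNegativeCycle CM A
    feasible⇒noNegativeCycle (e ∷ es) (w , _) = ℤP.≤⇒≯ $ ℤ-+-cancelˡ-≤ (π (tail e)) $ begin
      π (tail e) ℤ.+ + 0              ≡⟨ ℤP.+-identityʳ (π (tail e)) ⟩
      π (tail e)                      ≤⟨ feasible-walk w ⟩
      π (tail e) ℤ.+ cost CM (e ∷ es) ∎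

    -- The slacks of the edges of a walk are nonnegative and sum to π s + cost − π t.
    cheap-walk⇒tight : ∀ {s t es} → Walk A s t es → π s ℤ.+ cost CM es ℤ.≤ π t → All Tight es
    cheap-walk⇒tight nil _ = []
    cheap-walk⇒tight {t = t} (cons {es = es} e p w) cheap = tight ∷ cheap-walk⇒tight w cheap′
      where
      tight : Tight e
      tight = ℤ-+-cancelʳ-≤ (cost CM es) $ begin
        π (tail e) ℤ.+ edgeCost CM e ℤ.+ cost CM es ≡⟨ ℤP.+-assoc (π (tail e)) (edgeCost CM e) (cost CM es) ⟩
        π (tail e) ℤ.+ cost CM (e ∷ es)             ≤⟨ cheap ⟩
        π t                                         ≤⟨ feasible-walk w ⟩
        π (head e) ℤ.+ cost CM es                   ∎
      cheap′ : π (head e) ℤ.+ cost CM es ℤ.≤ π t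
      cheap′ = begin
        π (head e) ℤ.+ cost CM es                   ≤⟨ ℤP.+-monoˡ-≤ (cost CM es) (feasible e p) ⟩
        π (tail e) ℤ.+ edgeCost CM e ℤ.+ cost CM es ≡⟨ ℤP.+-assoc (π (tail e)) (edgeCost CM e) (cost CM es) ⟩
        π (tail e) ℤ.+ cost CM (e ∷ es)             ≤⟨ cheap ⟩
        π t                                         ∎

    -- The loop s → s, which is not an edge of Γ(A), costs 0.
    feasible-from-occupied : ∀ {s d} → A d ≡ just s → ∀ r → π r ℤ.≤ π s ℤ.+ edgeCost CM (edge s r d)
    feasible-from-occupied {s} {d} occ r with r ≟ s
    ... | no r≢s   = feasible (edge s r d) (occ , r≢s)
    ... | yes refl = ℤP.≤-reflexive $ sym $
      trans (cong (λ c → π s ℤ.+ c) (ℤP.+-inverseʳ (+ CM d s))) (ℤP.+-identityʳ (π s))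

    tight-transfer : ∀ {e} → A (dem e) ≡ just (tail e) → Tight e →
                     ∀ r → π r ℤ.≤ π (head e) ℤ.+ edgeCost CM (edge (head e) r (dem e))
    tight-transfer {edge p q d} occ tight r = begin
      π r                                   ≤⟨ feasible-from-occupied occ r ⟩
      π p ℤ.+ (cᵣ ℤ.- cₚ)                   ≡⟨ rebase (π p) cᵣ cₚ c_q ⟩
      π p ℤ.+ (c_q ℤ.- cₚ) ℤ.+ (cᵣ ℤ.- c_q) ≤⟨ ℤP.+-monoˡ-≤ (cᵣ ℤ.- c_q) tight ⟩
      π q ℤ.+ (cᵣ ℤ.- c_q)                  ∎
      where
      cₚ = + CM d p
      c_q = + CM d q
      cᵣ = + CM d r
      rebase : ∀ x a b c → x ℤ.+ (a ℤ.- b) ≡ x ℤ.+ (c ℤ.- b) ℤ.+ (a ℤ.- c)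
      rebase = solve-∀

    feasible-transferAll : ∀ {es} → All (InΓ A) es → All Tight es → Feasible (transferAll A es)
    feasible-transferAll {es} inΓ tight (edge p q d) (occ , q≢p) with transferAll-cases A es d
    ... | inj₁ unchanged = feasible (edge p q d) (trans (sym unchanged) occ , q≢p)
    ... | inj₂ (e , e∈es , refl , moved) with MaybeP.just-injective (trans (sym moved) occ)
    ...   | refl = tight-transfer (proj₁ (All.lookup inΓ e∈es)) (All.lookup tight e∈es) q

module Distances {n m} {CM : CostMatrix n m} {A : Allotment n m} (noNegativeCycle : NoNegativeCycle CM A)
                 {s} (shortest : ∀ v → ShortestPath CM A s v) where
  open ShortestPath
  open ℤP.≤-Reasoning
  open DecMembership (_≟_ {m}) using (_∈?_)

  route : Fin m → List (Edge n m)
  route v = path (shortest v)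

  dist : Fin m → ℤ
  dist v = cost CM (route v)

  dist-feasible : Feasible CM dist A
  dist-feasible e p with head e ∈? vertices s (route (tail e))
  ... | no head∉ = begin
    dist (head e)                   ≤⟨ minimal (shortest (head e)) (path-∷ʳ (isPath (shortest (tail e))) p head∉) ⟩
    cost CM (route (tail e) ∷ʳ e)   ≡⟨ cost-∷ʳ CM (route (tail e)) e ⟩
    dist (tail e) ℤ.+ edgeCost CM e ∎
  ... | yes head∈ with split-path (isPath (shortest (tail e))) head∈
  ...   | es₁ , es₂ , split , path₁ , path₂ = begin
    dist (head e)                                ≤⟨ minimal (shortest (head e)) path₁ ⟩
    cost CM es₁                                  ≡⟨ sym (ℤP.+-identityʳ (cost CM es₁)) ⟩
    cost CM es₁ ℤ.+ + 0                          ≤⟨ ℤP.+-monoʳ-≤ (cost CM es₁) cycle-nonnegative ⟩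
    cost CM es₁ ℤ.+ cost CM (es₂ ∷ʳ e)           ≡⟨ sym (cost-++ CM es₁ (es₂ ∷ʳ e)) ⟩
    cost CM (es₁ ++ es₂ ∷ʳ e)                    ≡⟨ cong (cost CM) (sym (LP.++-assoc es₁ es₂ [ e ])) ⟩
    cost CM ((es₁ ++ es₂) ∷ʳ e)                  ≡⟨ cost-∷ʳ CM (es₁ ++ es₂) e ⟩
    cost CM (es₁ ++ es₂) ℤ.+ edgeCost CM e       ≡⟨ cong (λ es → cost CM es ℤ.+ edgeCost CM e) (sym split) ⟩
    dist (tail e) ℤ.+ edgeCost CM e              ∎
    where
    cycle-nonnegative : + 0 ℤ.≤ cost CM (es₂ ∷ʳ e)
    cycle-nonnegative = ℤP.≮⇒≥ (noNegativeCycle _ (path-∷ʳ-cycle path₂ p))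

  cheapest⇒tight : ∀ {t es} → IsPath A s t es →
                   (∀ {es′} → IsPath A s t es′ → cost CM es ℤ.≤ cost CM es′) → All (Tight CM dist) es
  cheapest⇒tight {t} {es} (w , _) cheapest = cheap-walk⇒tight CM dist dist-feasible w $ begin
    dist s ℤ.+ cost CM es ≤⟨ ℤP.+-monoˡ-≤ (cost CM es) (minimal (shortest s) (nil , [] ∷ [])) ⟩
    + 0 ℤ.+ cost CM es    ≡⟨ ℤP.+-identityˡ (cost CM es) ⟩
    cost CM es            ≤⟨ cheapest (isPath (shortest t)) ⟩
    dist t                ∎

lemma4p2 : ∀ {n m : ℕ} (CM : CostMatrix n m)
    → (∀ d s → 0 < CM d s)
    → (A3 : Allotment n m)
    → NoNegativeCycle CM A3
    → (s* : Fin m)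
    → (w : Fin m → ℚ)
    → (sl : Fin m) → sl ≢ s*
    → (P : List (Edge n m)) → IsPath A3 s* sl P
    → (∀ (u : Fin m) → u ≢ s* → (Q : List (Edge n m)) → IsPath A3 s* u Q
         → value CM w sl P ≤ value CM w u Q)
    → NoNegativeCycle CM (nextAllotment CM w A3 sl P)
lemma4p2 CM _ A3 noNegativeCycle s* w sl sl≢s* P P-path P-minimal with value CM w sl P ℚP.<? 0ℚ
... | no _  = noNegativeCycle
... | yes _ = feasible⇒noNegativeCycle CM dist $
    feasible-transferAll CM dist dist-feasible (walk-edges (proj₁ P-path)) (cheapest⇒tight P-path P-cheapest)
  where
  open Distances noNegativeCycle
    (shortestPath ∘ occupied⇒path (proj₂ (occupied-source (proj₁ P-path) sl≢s*)))
  P-cheapest : ∀ {Q} → IsPath A3 s* sl Q → cost CM P ℤ.≤ cost CM Q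
  P-cheapest {Q} Q-path = toℚ-cancel-≤ (ℚ-+-cancelʳ-≤ (w sl) (P-minimal sl sl≢s* Q Q-path))
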